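{- Let $G$ be a connected graph with vertex set $\{1,\dots,n\}$, $n\ge 2$, let $\Phi=(F_1,\dots,F_n)$ be an $n$-tuple of pairwise disjoint graphs, and let $G[\Phi]$ be the generalized lexicographic product. If $i(F_1)=i(F_2)=\dots=i(F_n)$, then $i(G[\Phi])=i(G)\,i(F_1)$. If $\beta_0(F_1)=\beta_0(F_2)=\dots=\beta_0(F_n)$, then $\beta_0(G[\Phi])=\beta_0(G)\,\beta_0(F_1)$.
   Context: All graphs are finite, simple and undirected. The generalized lexicographic product $G[\Phi]$ is the graph with vertex set $\bigcup_{i=1}^n V(F_i)$ in which each $F_i$ is an induced subgraph, and for $x\in V(F_i)$, $y\in V(F_j)$ with $i\neq j$, $xy$ is an edge iff $ij\in E(G)$. $i(H)$ is the minimum cardinality of a maximal independent set of $H$ (independent domination number) and $\beta_0(H)$ the maximum cardinality of an independent set (independence number). -}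

module Defs where

open import Data.Nat using (ℕ; zero; suc; _+_; _*_; _≤_)
open import Data.Fin using (Fin; zero; suc; splitAt; _≟_)
open import Data.Fin.Subset using (Subset; _∈_; _⊆_; ∣_∣)
open import Data.Bool using (Bool; true; false)
open import Data.Product using (Σ; _×_; _,_; ∃)
open import Data.Sum using (inj₁; inj₂)
open import Relation.Nullary using (yes; no)
open import Relation.Binary.PropositionalEquality using (_≡_; refl)

record Graph (m : ℕ) : Set where
  field
    adj    : Fin m → Fin m → Bool
    sym    : ∀ x y → adj x y ≡ adj y x
    irrefl : ∀ x → adj x x ≡ false
open Graph public

data Reach {m : ℕ} (G : Graph m) : Fin m → Fin m → Set where
  here : ∀ {x} → Reach G x x
  step : ∀ {x y z} → adj G x y ≡ true → Reach G y z → Reach G x z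

Connected : ∀ {m} → Graph m → Set
Connected G = ∀ x y → Reach G x y

Independent : ∀ {m} → Graph m → Subset m → Set
Independent G S = ∀ x y → x ∈ S → y ∈ S → adj G x y ≡ false

MaximalIndependent : ∀ {m} → Graph m → Subset m → Set
MaximalIndependent G S =
  Independent G S × (∀ T → Independent G T → S ⊆ T → T ⊆ S)

IsIndepDomNum : ∀ {m} → Graph m → ℕ → Set
IsIndepDomNum G k =
  (Σ _ λ S → MaximalIndependent G S × ∣ S ∣ ≡ k)
  × (∀ S → MaximalIndependent G S → k ≤ ∣ S ∣)

IsIndepNum : ∀ {m} → Graph m → ℕ → Set
IsIndepNum G k =
  (Σ _ λ S → Independent G S × ∣ S ∣ ≡ k)
  × (∀ S → Independent G S → ∣ S ∣ ≤ k)

total : ∀ {n} → (Fin n → ℕ) → ℕ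
total {zero}  ord = 0
total {suc n} ord = ord zero + total (λ i → ord (suc i))

-- vertices of G[Φ], numbered block by block: vertex v lies in block i
-- and is vertex x of F_i
decode : ∀ {n} (ord : Fin n → ℕ) → Fin (total ord) → Σ (Fin n) (λ i → Fin (ord i))
decode {suc n} ord v with splitAt (ord zero) v
... | inj₁ x = zero , x
... | inj₂ w with decode (λ i → ord (suc i)) w
...   | i , x = suc i , x

lexAdj₀ : ∀ {n} {ord : Fin n → ℕ} → Graph n → ((i : Fin n) → Graph (ord i))
        → Σ (Fin n) (λ i → Fin (ord i)) → Σ (Fin n) (λ i → Fin (ord i)) → Bool
lexAdj₀ G F (i , x) (j , y) with i ≟ j
... | yes refl = adj (F i) x y
... | no _     = adj G i j

-- the generalized lexicographic product G[Φ], Φ = (F_1,…,F_n)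
-- (the F_i are made pairwise disjoint by taking their disjoint union)
lexProduct : ∀ {n} {ord : Fin n → ℕ} → Graph n → ((i : Fin n) → Graph (ord i))
           → Graph (total ord)
lexProduct {n} {ord} G F = record
  { adj    = λ u v → lexAdj₀ G F (decode ord u) (decode ord v)
  ; sym    = λ u v → symP (decode ord u) (decode ord v)
  ; irrefl = λ u → irrP (decode ord u)
  }
  where
  symP : ∀ p q → lexAdj₀ G F p q ≡ lexAdj₀ G F q p
  symP (i , x) (j , y) with i ≟ j | j ≟ i
  ... | yes refl | yes refl = sym (F i) x y
  ... | yes refl | no ¬p with ¬p refl
  ...   | ()
  symP (i , x) (j , y) | no ¬p | yes refl with ¬p refl
  ... | ()
  symP (i , x) (j , y) | no _ | no _ = sym G i j
  irrP : ∀ p → lexAdj₀ G F p p ≡ false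
  irrP (i , x) with i ≟ i
  ... | yes refl = irrefl (F i) x
  ... | no ¬p with ¬p refl
  ...   | ()

-- A vertex set S of G[Φ] is described by its traces on the blocks F_i and by its support, the
-- set of indices whose block S meets. Edges between distinct blocks are those of G, so S is
-- (maximal) independent iff its support is (maximal) independent in G and its nonempty traces
-- are (maximal) independent in the F_i. Counting block by block then bounds |S| by
-- |support| · k from either side. Conversely, for optimal sets I of G and T_i of F_i the union
-- of the T_i over i ∈ I is optimal in G[Φ]; it has size |I| · k because all T_i have size k.
module Submission where

open import Defs hiding (sym)
open import Data.Nat using (ℕ; zero; suc; _+_; _*_; _≤_; z≤n; s≤s)
open import Data.Nat.Properties using (+-mono-≤; ≤-trans; ≤-antisym; ≤-reflexive; m≤n+m; *-monoˡ-≤; *-zeroʳ)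
open import Data.Fin using (Fin; zero; suc; splitAt; _↑ˡ_; _↑ʳ_; _≟_)
open import Data.Fin.Properties using (splitAt-↑ˡ; splitAt-↑ʳ; splitAt⁻¹-↑ˡ; splitAt⁻¹-↑ʳ; any?)
open import Data.Fin.Subset using (Subset; _∈_; _∉_; _⊆_; ∣_∣; ⊥; ⁅_⁆; _∪_; Nonempty; inside; outside)
open import Data.Fin.Subset.Properties
  using (_∈?_; drop-there; nonempty?; Empty-unique; ∣⊥∣≡0; ∉⊥; ∣⁅x⁆∣≡1; x∈⁅x⁆; x∈⁅y⁆⇒x≡y; p⊆q⇒∣p∣≤∣q∣; p⊆p∪q; x∈p∪q⁺; x∈p∪q⁻)
open import Data.Vec using ([]; _∷_; _++_; lookup; tabulate; here; there)
open import Data.Vec.Properties using (lookup∘tabulate; tabulate∘lookup; tabulate-cong; lookup-++ˡ; lookup-++ʳ; []=⇒lookup; lookup⇒[]=)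
open import Data.Bool using (true; false; if_then_else_)
open import Data.Bool.Properties using () renaming (_≟_ to _≟ᵇ_)
open import Data.Product using (Σ; _×_; _,_; ∃; proj₁; proj₂)
open import Data.Sum using (inj₁; inj₂)
open import Function using (_∘_)
open import Relation.Nullary using (yes; no; does; contradiction)
open import Relation.Nullary.Decidable using (_×-dec_; dec-true)
open import Relation.Binary.PropositionalEquality

Dominating : ∀ {m} → Graph m → Subset m → Set
Dominating G S = ∀ x → x ∉ S → ∃ λ y → y ∈ S × adj G x y ≡ true

module _ {m : ℕ} (G : Graph m) where

  adj⇒≢ : ∀ {x y} → adj G x y ≡ true → x ≢ y
  adj⇒≢ {x} e refl = contradiction (trans (sym e) (irrefl G x)) λ ()

  maximal⇒dominating : ∀ {S} → MaximalIndependent G S → Dominating G S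
  maximal⇒dominating {S} (indS , maxS) x x∉S
    with any? (λ y → (y ∈? S) ×-dec (adj G x y ≟ᵇ true))
  ... | yes witness = witness
  ... | no noNeighbour = contradiction (maxS (S ∪ ⁅ x ⁆) indS+x (p⊆p∪q ⁅ x ⁆) (x∈p∪q⁺ (inj₂ (x∈⁅x⁆ x)))) x∉S
    where
    nonadjacent : ∀ y → y ∈ S → adj G x y ≡ false
    nonadjacent y y∈S with adj G x y in e
    ... | true  = contradiction (y , y∈S , e) noNeighbour
    ... | false = refl

    indS+x : Independent G (S ∪ ⁅ x ⁆)
    indS+x a b a∈ b∈ with x∈p∪q⁻ S ⁅ x ⁆ a∈ | x∈p∪q⁻ S ⁅ x ⁆ b∈
    ... | inj₁ a∈S | inj₁ b∈S = indS a b a∈S b∈S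
    ... | inj₂ a=x | inj₁ b∈S rewrite x∈⁅y⁆⇒x≡y x a=x = nonadjacent b b∈S
    ... | inj₁ a∈S | inj₂ b=x rewrite x∈⁅y⁆⇒x≡y x b=x = trans (Graph.sym G a x) (nonadjacent a a∈S)
    ... | inj₂ a=x | inj₂ b=x rewrite x∈⁅y⁆⇒x≡y x a=x | x∈⁅y⁆⇒x≡y x b=x = irrefl G x

  dominating⇒maximal : ∀ {S} → Independent G S → Dominating G S → MaximalIndependent G S
  dominating⇒maximal {S} indS domS = indS , λ T indT S⊆T {x} x∈T → inS T indT S⊆T x x∈T
    where
    inS : ∀ T → Independent G T → S ⊆ T → ∀ x → x ∈ T → x ∈ S
    inS T indT S⊆T x x∈T with x ∈? S
    ... | yes x∈S = x∈S
    ... | no x∉S with domS x x∉S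
    ...   | y , y∈S , e = contradiction (trans (sym e) (indT x y x∈T (S⊆T y∈S))) λ ()

  dominating⇒nonempty : ∀ {S} → Dominating G S → Fin m → Nonempty S
  dominating⇒nonempty {S} domS x with x ∈? S
  ... | yes x∈S = x , x∈S
  ... | no x∉S = proj₁ (domS x x∉S) , proj₁ (proj₂ (domS x x∉S))

module _ {m : ℕ} {p : Subset m} where

  ∈⇒1≤∣p∣ : ∀ {x} → x ∈ p → 1 ≤ ∣ p ∣
  ∈⇒1≤∣p∣ {x} x∈p = subst (_≤ ∣ p ∣) (∣⁅x⁆∣≡1 x) (p⊆q⇒∣p∣≤∣q∣ ⁅x⁆⊆p)
    where
    ⁅x⁆⊆p : ⁅ x ⁆ ⊆ p
    ⁅x⁆⊆p y∈⁅x⁆ = subst (_∈ p) (sym (x∈⁅y⁆⇒x≡y x y∈⁅x⁆)) x∈p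

  1≤∣p∣⇒nonempty : 1 ≤ ∣ p ∣ → Nonempty p
  1≤∣p∣⇒nonempty 1≤∣p∣ with nonempty? p
  ... | yes ne = ne
  ... | no empty with subst (1 ≤_) (trans (cong ∣_∣ (Empty-unique empty)) (∣⊥∣≡0 m)) 1≤∣p∣
  ...   | ()

∈-by-lookup : ∀ {a b} {p : Subset a} {q : Subset b} {x y} → lookup p x ≡ lookup q y → x ∈ p → y ∈ q
∈-by-lookup {q = q} {y = y} eq x∈p = lookup⇒[]= y q (trans (sym eq) ([]=⇒lookup x∈p))

∣p++q∣ : ∀ {a b} (p : Subset a) (q : Subset b) → ∣ p ++ q ∣ ≡ ∣ p ∣ + ∣ q ∣
∣p++q∣ []            q = refl
∣p++q∣ (outside ∷ p) q = ∣p++q∣ p q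
∣p++q∣ (inside  ∷ p) q = cong suc (∣p++q∣ p q)

total≤∣I∣*k : ∀ {n k} (c : Fin n → ℕ) (I : Subset n)
  → (∀ i → i ∉ I → c i ≡ 0) → (∀ i → i ∈ I → c i ≤ k) → total c ≤ ∣ I ∣ * k
total≤∣I∣*k c []            _     _     = z≤n
total≤∣I∣*k c (inside ∷ I)  out≡0 in≤k =
  +-mono-≤ (in≤k zero here) (total≤∣I∣*k (c ∘ suc) I (λ i i∉ → out≡0 (suc i) (i∉ ∘ drop-there)) (λ i → in≤k (suc i) ∘ there))
total≤∣I∣*k c (outside ∷ I) out≡0 in≤k =
  subst (λ c₀ → c₀ + total (c ∘ suc) ≤ ∣ I ∣ * _) (sym (out≡0 zero λ ()))
    (total≤∣I∣*k (c ∘ suc) I (λ i i∉ → out≡0 (suc i) (i∉ ∘ drop-there)) (λ i → in≤k (suc i) ∘ there))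

∣I∣*k≤total : ∀ {n k} (c : Fin n → ℕ) (I : Subset n) → (∀ i → i ∈ I → k ≤ c i) → ∣ I ∣ * k ≤ total c
∣I∣*k≤total c []            _    = z≤n
∣I∣*k≤total c (inside ∷ I)  k≤in = +-mono-≤ (k≤in zero here) (∣I∣*k≤total (c ∘ suc) I (λ i → k≤in (suc i) ∘ there))
∣I∣*k≤total c (outside ∷ I) k≤in = ≤-trans (∣I∣*k≤total (c ∘ suc) I (λ i → k≤in (suc i) ∘ there)) (m≤n+m _ (c zero))

Vertex : ∀ {n} → (Fin n → ℕ) → Set
Vertex {n} ord = Σ (Fin n) (λ i → Fin (ord i))

encode : ∀ {n} {ord : Fin n → ℕ} → Vertex ord → Fin (total ord)
encode {suc n} {ord} (zero  , x) = x ↑ˡ total (ord ∘ suc)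
encode {suc n} {ord} (suc i , x) = ord zero ↑ʳ encode (i , x)

decode-encode : ∀ {n} {ord : Fin n → ℕ} (v : Vertex ord) → decode ord (encode v) ≡ v
decode-encode {suc n} {ord} (zero , x) rewrite splitAt-↑ˡ (ord zero) x (total (ord ∘ suc)) = refl
decode-encode {suc n} {ord} (suc i , x)
  rewrite splitAt-↑ʳ (ord zero) (total (ord ∘ suc)) (encode (i , x))
        | decode-encode {ord = ord ∘ suc} (i , x) = refl

encode-decode : ∀ {n} (ord : Fin n → ℕ) (u : Fin (total ord)) → encode (decode ord u) ≡ u
encode-decode {suc n} ord u with splitAt (ord zero) u in split
... | inj₁ x = splitAt⁻¹-↑ˡ split
... | inj₂ w with decode (ord ∘ suc) w in dw
...   | i , x = trans (cong (ord zero ↑ʳ_) (trans (cong encode (sym dw)) (encode-decode (ord ∘ suc) w))) (splitAt⁻¹-↑ʳ split)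

concat : ∀ {n} {ord : Fin n → ℕ} → ((i : Fin n) → Subset (ord i)) → Subset (total ord)
concat {zero}  B = []
concat {suc n} B = B zero ++ concat (B ∘ suc)

lookup-concat : ∀ {n} {ord : Fin n → ℕ} (B : (i : Fin n) → Subset (ord i)) (v : Vertex ord)
  → lookup (concat B) (encode v) ≡ lookup (B (proj₁ v)) (proj₂ v)
lookup-concat {suc n} B (zero  , x) = lookup-++ˡ (B zero) (concat (B ∘ suc)) x
lookup-concat {suc n} B (suc i , x) = trans (lookup-++ʳ (B zero) _ (encode (i , x))) (lookup-concat (B ∘ suc) (i , x))

∣concat∣ : ∀ {n} {ord : Fin n → ℕ} (B : (i : Fin n) → Subset (ord i)) → ∣ concat B ∣ ≡ total (λ i → ∣ B i ∣)
∣concat∣ {zero}  B = refl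
∣concat∣ {suc n} B = trans (∣p++q∣ (B zero) (concat (B ∘ suc))) (cong (∣ B zero ∣ +_) (∣concat∣ (B ∘ suc)))

module Blocks {n : ℕ} {ord : Fin n → ℕ} where

  ∀-vertex : {Q : Fin (total ord) → Set} → (∀ v → Q (encode v)) → ∀ u → Q u
  ∀-vertex {Q} h u = subst Q (encode-decode ord u) (h (decode ord u))

  ∃-vertex : {Q : Fin (total ord) → Set} → ∃ Q → ∃ λ v → Q (encode v)
  ∃-vertex {Q} (u , q) = decode ord u , subst Q (sym (encode-decode ord u)) q

  block : Subset (total ord) → (i : Fin n) → Subset (ord i)
  block S i = tabulate (λ x → lookup S (encode (i , x)))

  lookup-block : ∀ S i x → lookup (block S i) x ≡ lookup S (encode (i , x))
  lookup-block S i x = lookup∘tabulate _ x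

  ∈-block⁺ : ∀ {S i x} → encode (i , x) ∈ S → x ∈ block S i
  ∈-block⁺ {S} {i} {x} = ∈-by-lookup (sym (lookup-block S i x))

  ∈-block⁻ : ∀ {S i x} → x ∈ block S i → encode (i , x) ∈ S
  ∈-block⁻ {S} {i} {x} = ∈-by-lookup (lookup-block S i x)

  concat-block : ∀ S → concat (block S) ≡ S
  concat-block S = begin
    concat (block S)                     ≡⟨ tabulate∘lookup _ ⟨
    tabulate (lookup (concat (block S))) ≡⟨ tabulate-cong (∀-vertex same-lookup) ⟩
    tabulate (lookup S)                  ≡⟨ tabulate∘lookup S ⟩
    S                                    ∎
    where
    open ≡-Reasoning
    same-lookup : ∀ v → lookup (concat (block S)) (encode v) ≡ lookup S (encode v)
    same-lookup v = trans (lookup-concat (block S) v) (lookup-block S (proj₁ v) (proj₂ v))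

  ∣S∣≡total∣block∣ : ∀ S → ∣ S ∣ ≡ total (λ i → ∣ block S i ∣)
  ∣S∣≡total∣block∣ S = trans (cong ∣_∣ (sym (concat-block S))) (∣concat∣ (block S))

  support : Subset (total ord) → Subset n
  support S = tabulate (λ i → does (nonempty? (block S i)))

  ∈-support⁺ : ∀ S {i} → Nonempty (block S i) → i ∈ support S
  ∈-support⁺ S {i} ne = lookup⇒[]= i (support S) (trans (lookup∘tabulate _ i) (dec-true (nonempty? _) ne))

  ∈-support⁻ : ∀ S {i} → i ∈ support S → Nonempty (block S i)
  ∈-support⁻ S {i} i∈ with nonempty? (block S i) | trans (sym (lookup∘tabulate _ i)) ([]=⇒lookup i∈)
  ... | yes ne | _ = ne
  ... | no _   | ()

  ∣block∣≡0 : ∀ {S i} → i ∉ support S → ∣ block S i ∣ ≡ 0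
  ∣block∣≡0 {S} {i} i∉ = trans (cong ∣_∣ (Empty-unique (i∉ ∘ ∈-support⁺ S))) (∣⊥∣≡0 (ord i))

  ∣S∣≤∣support∣*k : ∀ {k} S → (∀ i → ∣ block S i ∣ ≤ k) → ∣ S ∣ ≤ ∣ support S ∣ * k
  ∣S∣≤∣support∣*k S ≤k = ≤-trans (≤-reflexive (∣S∣≡total∣block∣ S))
    (total≤∣I∣*k (λ i → ∣ block S i ∣) (support S) (λ i → ∣block∣≡0 {S}) (λ i _ → ≤k i))

  ∣support∣*k≤∣S∣ : ∀ {k} S → (∀ i → Nonempty (block S i) → k ≤ ∣ block S i ∣) → ∣ support S ∣ * k ≤ ∣ S ∣
  ∣support∣*k≤∣S∣ S k≤ = ≤-trans
    (∣I∣*k≤total (λ i → ∣ block S i ∣) (support S) (λ i → k≤ i ∘ ∈-support⁻ S))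
    (≤-reflexive (sym (∣S∣≡total∣block∣ S)))

  restrict : Subset n → ((i : Fin n) → Subset (ord i)) → (i : Fin n) → Subset (ord i)
  restrict I T i = if lookup I i then T i else ⊥

  restrict-∈ : ∀ I T {i} → i ∈ I → restrict I T i ≡ T i
  restrict-∈ I T i∈ rewrite []=⇒lookup i∈ = refl

  restrict-∉ : ∀ I T {i} → i ∉ I → restrict I T i ≡ ⊥
  restrict-∉ I T {i} i∉ with lookup I i in e
  ... | true  = contradiction (lookup⇒[]= i I e) i∉
  ... | false = refl

  ∈-restrict⁻ : ∀ {I T i x} → x ∈ restrict I T i → i ∈ I × x ∈ T i
  ∈-restrict⁻ {I} {T} {i} {x} x∈ with i ∈? I
  ... | yes i∈ = i∈ , subst (x ∈_) (restrict-∈ I T i∈) x∈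
  ... | no i∉  = contradiction (subst (x ∈_) (restrict-∉ I T i∉) x∈) ∉⊥

  inflate : Subset n → ((i : Fin n) → Subset (ord i)) → Subset (total ord)
  inflate I T = concat (restrict I T)

  ∈-inflate⁺ : ∀ {I T i x} → i ∈ I → x ∈ T i → encode (i , x) ∈ inflate I T
  ∈-inflate⁺ {I} {T} {i} {x} i∈ x∈ =
    ∈-by-lookup (sym (lookup-concat (restrict I T) (i , x))) (subst (x ∈_) (sym (restrict-∈ I T i∈)) x∈)

  ∈-inflate⁻ : ∀ {I T i x} → encode (i , x) ∈ inflate I T → i ∈ I × x ∈ T i
  ∈-inflate⁻ {I} {T} {i} {x} = ∈-restrict⁻ {I} {T} ∘ ∈-by-lookup (lookup-concat (restrict I T) (i , x))

  ∣inflate∣ : ∀ {k} I T → (∀ i → ∣ T i ∣ ≡ k) → ∣ inflate I T ∣ ≡ ∣ I ∣ * k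
  ∣inflate∣ {k} I T ∣T∣≡k = trans (∣concat∣ (restrict I T)) (≤-antisym
    (total≤∣I∣*k _ I ∣restrict∣≡0 (λ i → ≤-reflexive ∘ ∣restrict∣≡k i))
    (∣I∣*k≤total _ I (λ i → ≤-reflexive ∘ sym ∘ ∣restrict∣≡k i)))
    where
    ∣restrict∣≡0 : ∀ i → i ∉ I → ∣ restrict I T i ∣ ≡ 0
    ∣restrict∣≡0 i i∉ = trans (cong ∣_∣ (restrict-∉ I T i∉)) (∣⊥∣≡0 (ord i))
    ∣restrict∣≡k : ∀ i → i ∈ I → ∣ restrict I T i ∣ ≡ k
    ∣restrict∣≡k i i∈ = trans (cong ∣_∣ (restrict-∈ I T i∈)) (∣T∣≡k i)

module _ {n : ℕ} {ord : Fin n → ℕ} (G : Graph n) (F : (i : Fin n) → Graph (ord i)) where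

  open Blocks {n} {ord}

  private
    P : Graph (total ord)
    P = lexProduct G F

    adj-encode : ∀ v w → adj P (encode v) (encode w) ≡ lexAdj₀ G F v w
    adj-encode v w rewrite decode-encode v | decode-encode w = refl

  adj-same-block : ∀ i x y → adj P (encode (i , x)) (encode (i , y)) ≡ adj (F i) x y
  adj-same-block i x y with i ≟ i | adj-encode (i , x) (i , y)
  ... | yes refl | e = e
  ... | no i≢i   | _ = contradiction refl i≢i

  adj-other-block : ∀ {i j} x y → i ≢ j → adj P (encode (i , x)) (encode (j , y)) ≡ adj G i j
  adj-other-block {i} {j} x y i≢j with i ≟ j | adj-encode (i , x) (j , y)
  ... | yes i≡j | _ = contradiction i≡j i≢j
  ... | no _    | e = e

  support-independent : ∀ {S} → Independent P S → Independent G (support S)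
  support-independent {S} indS i j i∈ j∈ with i ≟ j | ∈-support⁻ S i∈ | ∈-support⁻ S j∈
  ... | yes refl | _ | _ = irrefl G i
  ... | no i≢j | x , x∈ | y , y∈ = trans (sym (adj-other-block x y i≢j)) (indS _ _ (∈-block⁻ x∈) (∈-block⁻ y∈))

  block-independent : ∀ {S} → Independent P S → ∀ i → Independent (F i) (block S i)
  block-independent indS i x y x∈ y∈ = trans (sym (adj-same-block i x y)) (indS _ _ (∈-block⁻ x∈) (∈-block⁻ y∈))

  support-dominating : ∀ {S} → Dominating P S → (∀ j → Fin (ord j)) → Dominating G (support S)
  support-dominating {S} domS vertex j j∉
    with ∃-vertex (domS (encode (j , vertex j)) (λ u∈ → j∉ (∈-support⁺ S (vertex j , ∈-block⁺ u∈))))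
  ... | (i , z) , z∈ , e with j ≟ i
  ...   | yes refl = contradiction (∈-support⁺ S (z , ∈-block⁺ z∈)) j∉
  ...   | no j≢i = i , ∈-support⁺ S (z , ∈-block⁺ z∈) , trans (sym (adj-other-block (vertex j) z j≢i)) e

  block-dominating : ∀ {S i} → Independent P S → Dominating P S → Nonempty (block S i) → Dominating (F i) (block S i)
  block-dominating {S} {i} indS domS (z , z∈) x x∉ with ∃-vertex (domS (encode (i , x)) (x∉ ∘ ∈-block⁺))
  ... | (j , y) , y∈ , e with i ≟ j
  ...   | yes refl = y , ∈-block⁺ y∈ , trans (sym (adj-same-block i x y)) e
  ...   | no i≢j = contradiction (trans (sym ij-edge) ij-non-edge) λ ()
    where
    ij-edge : adj G i j ≡ true
    ij-edge = trans (sym (adj-other-block x y i≢j)) e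
    ij-non-edge : adj G i j ≡ false
    ij-non-edge = trans (sym (adj-other-block z y i≢j)) (indS _ _ (∈-block⁻ z∈) y∈)

  support-maximal : ∀ {S} → MaximalIndependent P S → (∀ j → Fin (ord j)) → MaximalIndependent G (support S)
  support-maximal maxS vertex = dominating⇒maximal G (support-independent (proj₁ maxS))
    (support-dominating (maximal⇒dominating P maxS) vertex)

  block-maximal : ∀ {S i} → MaximalIndependent P S → Nonempty (block S i) → MaximalIndependent (F i) (block S i)
  block-maximal {i = i} maxS ne = dominating⇒maximal (F i) (block-independent (proj₁ maxS) i)
    (block-dominating (proj₁ maxS) (maximal⇒dominating P maxS) ne)

  inflate-independent : ∀ {I T} → Independent G I → (∀ i → Independent (F i) (T i)) → Independent P (inflate I T)
  inflate-independent {I} {T} indI indT =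
    ∀-vertex {Q = λ u → ∀ w → u ∈ inflate I T → w ∈ inflate I T → adj P u w ≡ false} λ v →
    ∀-vertex {Q = λ w → encode v ∈ inflate I T → w ∈ inflate I T → adj P (encode v) w ≡ false} (nonadjacent v)
    where
    nonadjacent : ∀ v w → encode v ∈ inflate I T → encode w ∈ inflate I T → adj P (encode v) (encode w) ≡ false
    nonadjacent (i , x) (j , y) v∈ w∈ with ∈-inflate⁻ v∈ | ∈-inflate⁻ w∈ | i ≟ j
    ... | _ , x∈ | _ , y∈ | yes refl = trans (adj-same-block i x y) (indT i x y x∈ y∈)
    ... | i∈ , _ | j∈ , _ | no i≢j   = trans (adj-other-block x y i≢j) (indI i j i∈ j∈)

  inflate-dominating : ∀ {I T} → Dominating G I → (∀ i → Dominating (F i) (T i))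
    → (Fin (total ord) → ∀ i → Nonempty (T i)) → Dominating P (inflate I T)
  inflate-dominating {I} {T} domI domT nonempty =
    ∀-vertex {Q = λ u → u ∉ inflate I T → ∃ λ w → w ∈ inflate I T × adj P u w ≡ true} dominated
    where
    dominated : ∀ v → encode v ∉ inflate I T → ∃ λ w → w ∈ inflate I T × adj P (encode v) w ≡ true
    dominated (j , y) v∉ with j ∈? I
    ... | yes j∈ with domT j y (v∉ ∘ ∈-inflate⁺ j∈)
    ...   | z , z∈ , e = encode (j , z) , ∈-inflate⁺ j∈ z∈ , trans (adj-same-block j y z) e
    dominated (j , y) v∉ | no j∉ with domI j j∉
    ...   | i , i∈ , e with nonempty (encode (j , y)) i
    ...     | z , z∈ = encode (i , z) , ∈-inflate⁺ i∈ z∈ , trans (adj-other-block y z (adj⇒≢ G e)) e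

  inflate-maximal : ∀ {I T} → MaximalIndependent G I → (∀ i → MaximalIndependent (F i) (T i))
    → (Fin (total ord) → ∀ i → Nonempty (T i)) → MaximalIndependent P (inflate I T)
  inflate-maximal maxI maxT nonempty = dominating⇒maximal P
    (inflate-independent (proj₁ maxI) (proj₁ ∘ maxT))
    (inflate-dominating (maximal⇒dominating G maxI) (λ i → maximal⇒dominating (F i) (maxT i)) nonempty)

  maximal-lexProduct-≥ : ∀ {k g} → (∀ i S → MaximalIndependent (F i) S → k ≤ ∣ S ∣)
    → (∀ I → MaximalIndependent G I → g ≤ ∣ I ∣) → (1 ≤ k → ∀ j → Fin (ord j))
    → ∀ S → MaximalIndependent P S → g * k ≤ ∣ S ∣
  maximal-lexProduct-≥ {zero} {g} _ _ _ S _ = subst (_≤ ∣ S ∣) (sym (*-zeroʳ g)) z≤n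
  maximal-lexProduct-≥ {suc k} minF minG vertex S maxS = ≤-trans
    (*-monoˡ-≤ (suc k) (minG (support S) (support-maximal maxS (vertex (s≤s z≤n)))))
    (∣support∣*k≤∣S∣ S λ i ne → minF i (block S i) (block-maximal maxS ne))

  lexProduct-IsIndepNum : ∀ k b → (∀ i → IsIndepNum (F i) k) → IsIndepNum G b → IsIndepNum P (b * k)
  lexProduct-IsIndepNum k b hF ((I , indI , ∣I∣≡b) , maxG) =
    (inflate I T , inflate-independent indI (λ i → proj₁ (proj₂ (proj₁ (hF i))))
      , trans (∣inflate∣ I T (λ i → proj₂ (proj₂ (proj₁ (hF i))))) (cong (_* k) ∣I∣≡b))
    , λ S indS → ≤-trans
        (∣S∣≤∣support∣*k S (λ i → proj₂ (hF i) (block S i) (block-independent indS i)))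
        (*-monoˡ-≤ k (maxG (support S) (support-independent indS)))
    where
    T : (i : Fin n) → Subset (ord i)
    T i = proj₁ (proj₁ (hF i))

  lexProduct-IsIndepDomNum : ∀ k g → (∀ i → IsIndepDomNum (F i) k) → IsIndepDomNum G g → IsIndepDomNum P (g * k)
  lexProduct-IsIndepDomNum k g hF ((I , maxI , ∣I∣≡g) , minG) =
    (inflate I T , inflate-maximal maxI maxT nonempty , trans (∣inflate∣ I T ∣T∣≡k) (cong (_* k) ∣I∣≡g))
    , maximal-lexProduct-≥ (proj₂ ∘ hF) minG (λ 1≤k j → proj₁ (1≤∣p∣⇒nonempty {p = T j} (subst (1 ≤_) (sym (∣T∣≡k j)) 1≤k)))
    where
    T : (i : Fin n) → Subset (ord i)
    T i = proj₁ (proj₁ (hF i))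
    maxT : ∀ i → MaximalIndependent (F i) (T i)
    maxT i = proj₁ (proj₂ (proj₁ (hF i)))
    ∣T∣≡k : ∀ i → ∣ T i ∣ ≡ k
    ∣T∣≡k i = proj₂ (proj₂ (proj₁ (hF i)))

    -- A vertex of some F_j forces |T_j| = k ≥ 1, hence every T_i is nonempty.
    nonempty : Fin (total ord) → ∀ i → Nonempty (T i)
    nonempty u i with decode ord u
    ... | j , y = 1≤∣p∣⇒nonempty {p = T i} (subst (1 ≤_) (trans (∣T∣≡k j) (sym (∣T∣≡k i)))
      (∈⇒1≤∣p∣ (proj₂ (dominating⇒nonempty (F j) (maximal⇒dominating (F j) (maxT j)) y))))

theorem3p5 : (n : ℕ) (ord : Fin n → ℕ) (G : Graph n) (F : (i : Fin n) → Graph (ord i))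
    → 2 ≤ n → Connected G
    → (∀ (k g : ℕ) → (∀ i → IsIndepDomNum (F i) k) → IsIndepDomNum G g
         → IsIndepDomNum (lexProduct G F) (g * k))
    × (∀ (k b : ℕ) → (∀ i → IsIndepNum (F i) k) → IsIndepNum G b
         → IsIndepNum (lexProduct G F) (b * k))
theorem3p5 n ord G F _ _ = lexProduct-IsIndepDomNum G F , lexProduct-IsIndepNum G F
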